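{- In quantified modal logic $\mathbf{K}$ (with possibilist quantifiers $\boldsymbol\forall,\boldsymbol\exists$ and actualist first-order quantifiers $\boldsymbol\forall^\text{E},\boldsymbol\exists^\text{E}$ over individuals), let $\mathcal{P}$ be an uninterpreted constant for "positive properties" and define "Godlike" by $\mathcal{G}\,x \equiv \boldsymbol\forall Y.(\mathcal{P}\,Y \boldsymbol\rightarrow Y\,x)$. Assume the three axioms (A1') $\boldsymbol\neg\mathcal{P}(\lambda x.\, x\boldsymbol{\not=}x)$; (A2') $\boldsymbol\forall X\,Y.\,((\mathcal{P}\,X \boldsymbol\wedge (\boldsymbol\forall^\text{E} z.(X\,z\boldsymbol\rightarrow Y\,z) \boldsymbol\vee \boldsymbol\Box\boldsymbol\forall^\text{E} z.(X\,z\boldsymbol\rightarrow Y\,z))) \boldsymbol\rightarrow \mathcal{P}\,Y)$; (A3) $\boldsymbol\forall\mathcal{Z}.\,(\boldsymbol\forall X.(\mathcal{Z}\,X\boldsymbol\rightarrow\mathcal{P}\,X) \boldsymbol\rightarrow \boldsymbol\forall X.(\boldsymbol\Box\boldsymbol\forall^\text{E}u.(X\,u \boldsymbol\leftrightarrow \boldsymbol\forall Y.(\mathcal{Z}\,Y\boldsymbol\rightarrow Y\,u)) \boldsymbol\rightarrow \mathcal{P}\,X))$. Then it follows that a Godlike entity possibly exists and necessarily exists, i.e. $\boldsymbol\Diamond\boldsymbol\exists^\text{E}\mathcal{G}$ and $\boldsymbol\Box\boldsymbol\exists^\text{E}\mathcal{G}$ are valid.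
   Context: Higher-order modal logic is embedded in classical higher-order logic (Isabelle/HOL) via a shallow semantical embedding; $\mathcal{Z}$ is a third-order variable ranging over sets of properties, and $\boldsymbol\forall^\text{E}$ ranges over individuals existing at the current world. -}

module Defs where

open import Level using (Level; Lift; lift; lower) renaming (suc to lsuc; zero to lzero)
open import Data.Bool using (Bool; true; false; T)
open import Data.Product using (Σ; _×_; _,_)
open import Data.Sum using (_⊎_)
open import Data.Empty using (⊥)
open import Relation.Nullary using (¬_; Dec; does)
open import Relation.Binary.PropositionalEquality using (_≢_)

-- Classical metalogic (Isabelle/HOL is classical): excluded middle, used to
-- reflect meta-level (Set₁) propositions into HOL truth values (Bool).
Classical : Set₂
Classical = (A : Set₁) → Dec A

-- A Kripke frame with (varying) individual domains, for modal logic K: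
-- worlds W (type i), arbitrary accessibility R, all individuals D (type e),
-- and the existence predicate E x w ("x exists at w").
record Frame : Set₁ where
  field
    W : Set
    R : W → W → Set
    D : Set
    E : D → W → Set

module Embedding (F : Frame) where
  open Frame F public

  -- meta-level (lifted) formulas, i.e. world-dependent propositions
  σ : Set₂
  σ = W → Set₁

  -- HOL-level world-dependent truth values  (type i → bool)
  Bσ : Set
  Bσ = W → Bool

  Prop' : Set
  Prop' = D → Bσ

  PropSet : Set
  PropSet = Prop' → Bσ

  ↑ : Bσ → σ
  ↑ b w = Lift _ (T (b w))

  -- reflecting a formula-valued abstraction (λx. φ x) into a HOL property
  ⌜_⌝ : Classical → (D → σ) → Prop'
  ⌜ lem ⌝ φ x w = does (lem (φ x w))

  infixr 5 _m→_
  infixr 5 _m↔_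
  infixr 6 _m∨_
  infixr 7 _m∧_

  m¬_ : σ → σ
  (m¬ φ) w = ¬ φ w

  _m→_ : σ → σ → σ
  (φ m→ ψ) w = φ w → ψ w

  _m∧_ : σ → σ → σ
  (φ m∧ ψ) w = φ w × ψ w

  _m∨_ : σ → σ → σ
  (φ m∨ ψ) w = φ w ⊎ ψ w

  _m↔_ : σ → σ → σ
  φ m↔ ψ = (φ m→ ψ) m∧ (ψ m→ φ)

  □ : σ → σ
  □ φ w = (v : W) → R w v → φ v

  ◇ : σ → σ
  ◇ φ w = Σ W λ v → R w v × φ v

  mΠ : {A : Set} → (A → σ) → σ
  mΠ {A} φ w = (x : A) → φ x w

  ∀ᴱ : (D → σ) → σ
  ∀ᴱ φ w = (x : D) → E x w → φ x w

  ∃ᴱ : (D → σ) → σ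
  ∃ᴱ φ w = Σ D λ x → E x w × φ x w

  _m≠_ : D → D → σ
  (x m≠ y) w = Lift _ (x ≢ y)

  valid : σ → Set₁
  valid φ = (w : W) → φ w

  G : PropSet → D → σ
  G P x = mΠ λ (Y : Prop') → ↑ (P Y) m→ ↑ (Y x)

  A1' : Classical → PropSet → σ
  A1' lem P = m¬ ↑ (P (⌜ lem ⌝ λ x → x m≠ x))

  A2' : PropSet → σ
  A2' P = mΠ λ (X : Prop') → mΠ λ (Y : Prop') →
    (↑ (P X) m∧ (∀ᴱ (λ z → ↑ (X z) m→ ↑ (Y z))
                 m∨ □ (∀ᴱ (λ z → ↑ (X z) m→ ↑ (Y z)))))
    m→ ↑ (P Y)

  A3 : PropSet → σ
  A3 P = mΠ λ (Z : PropSet) →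
    (mΠ λ (X : Prop') → ↑ (Z X) m→ ↑ (P X))
    m→ (mΠ λ (X : Prop') →
          □ (∀ᴱ λ u → ↑ (X u) m↔ (mΠ λ (Y : Prop') → ↑ (Z Y) m→ ↑ (Y u)))
          m→ ↑ (P X))

-- The argument splits into three facts about an arbitrary world w.
--   * Positive properties are instantiated: if P X held at w but no existing
--     individual had X, then X would trivially imply the empty property
--     λx. x ≠ x, so (A2') would make the empty property positive, against (A1').
--   * Being Godlike is positive: (A3) with Z := P says that any property which
--     necessarily coincides with "has every positive property" is positive, and
--     the reflected property ⌜G⌝ does so by definition.
--   * Every world has an accessible world: otherwise every □-formula holds at
--     w, so (A3) with the empty set of properties makes the empty property
--     positive, again against (A1').
-- The first two give ∃ᴱ G at every world, hence □∃ᴱ G; together with the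
-- third they give ◇∃ᴱ G.  Classical reasoning (the `Classical` oracle) is
-- needed to turn the resulting double negations into positive statements.
module Submission where

open import Defs
open import Data.Product using (_×_; _,_; Σ)
open import Data.Sum using (inj₁)
open import Data.Bool using (T; false)
open import Data.Empty using (⊥-elim)
open import Level using (lift; lower)
open import Relation.Nullary using (¬_; Dec; yes; no; does)

byContradiction : Classical → {A : Set₁} → ¬ ¬ A → A
byContradiction lem {A} ¬¬a with lem A
... | yes a = a
... | no ¬a = ⊥-elim (¬¬a ¬a)

reflect : {A : Set₁} (d : Dec A) → T (does d) → A
reflect (yes a) _ = a

reify : {A : Set₁} (d : Dec A) → A → T (does d)
reify (yes _) _ = _
reify (no ¬a) a = ⊥-elim (¬a a)

module GodlikeArgument (lem : Classical) (F : Frame) where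
  open Embedding F

  empty : Prop'
  empty = ⌜ lem ⌝ λ x → x m≠ x

  ⌜⌝-sound : (φ : D → σ) {x : D} {w : W} → ↑ (⌜ lem ⌝ φ x) w → φ x w
  ⌜⌝-sound φ {x} {w} holds = reflect (lem (φ x w)) (lower holds)

  ⌜⌝-complete : (φ : D → σ) {x : D} {w : W} → φ x w → ↑ (⌜ lem ⌝ φ x) w
  ⌜⌝-complete φ {x} {w} φxw = lift (reify (lem (φ x w)) φxw)

  module _ (P : PropSet) where

    positiveInstantiated : valid (A1' lem P) → valid (A2' P) →
      (X : Prop') (w : W) → ↑ (P X) w → ¬ ¬ ∃ᴱ (λ z → ↑ (X z)) w
    positiveInstantiated a1 a2 X w pX noInstance =
      a1 w (a2 w X empty (pX , inj₁ X⊆empty))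
      where
      X⊆empty : ∀ᴱ (λ z → ↑ (X z) m→ ↑ (empty z)) w
      X⊆empty z ez xz = ⊥-elim (noInstance (z , ez , xz))

    -- Being Godlike is positive: apply (A3) to Z := P.
    godlikePositive : valid (A3 P) → (w : W) → ↑ (P (⌜ lem ⌝ (G P))) w
    godlikePositive a3 w = a3 w P (λ _ pY → pY) (⌜ lem ⌝ (G P))
      λ _ _ _ _ → ⌜⌝-sound (G P) , ⌜⌝-complete (G P)

    -- Every world sees some world: apply (A3) to the empty set of properties.
    serial : valid (A1' lem P) → valid (A3 P) → (w : W) → ¬ ¬ Σ W (R w)
    serial a1 a3 w noSuccessor =
      a1 w (a3 w noProperties (λ _ ()) empty
              λ v r → ⊥-elim (noSuccessor (v , r)))
      where
      noProperties : PropSet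
      noProperties _ _ = false

    godlikeExists : valid (A1' lem P) → valid (A2' P) → valid (A3 P) →
      valid (∃ᴱ (G P))
    godlikeExists a1 a2 a3 w = byContradiction lem λ noGod →
      positiveInstantiated a1 a2 (⌜ lem ⌝ (G P)) w (godlikePositive a3 w)
        λ { (z , ez , gz) → noGod (z , ez , ⌜⌝-sound (G P) gz) }

mainTheorem1 : (lem : Classical) (F : Frame) →
    let open Embedding F in
    (P : PropSet) →
    valid (A1' lem P) → valid (A2' P) → valid (A3 P) →
    valid (◇ (∃ᴱ (G P))) × valid (□ (∃ᴱ (G P)))
mainTheorem1 lem F P a1 a2 a3 = possibly , necessarily
  where
  open Embedding F
  open GodlikeArgument lem F

  necessarily : valid (□ (∃ᴱ (G P)))
  necessarily _ v _ = godlikeExists P a1 a2 a3 v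

  possibly : valid (◇ (∃ᴱ (G P)))
  possibly w = byContradiction lem λ impossible →
    serial P a1 a3 w λ { (v , r) → impossible (v , r , godlikeExists P a1 a2 a3 v) }
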